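{- There exists a universal constant $C$ such that for all positive integers $n,k,m$ with $k\ge 2$, \[\mathbb E[R_{n,k,m}]-\left(\frac{\log n}{m\log k}+1\right)\le C,\] where $R_{n,k,m}$ is the maximum power of length $m$ in a uniformly random word in $[k]^n$.
   Context: For a word $w=w_1\cdots w_n$ and positive integers $r,m$, an $r$-power of length $m$ in $w$ is a contiguous factor $w_i\cdots w_{i+rm-1}$ (with $i+rm-1\le n$) that is the concatenation of $r$ identical consecutive blocks each of length $m$, i.e. $w_j=w_{j+m}$ for all $i\le j\le i+(r-1)m-1$. The maximum power of length $m$ in $w$ is the largest $r$ such that $w$ contains an $r$-power of length $m$. The random word is uniform over $[k]^n$ with $[k]=\{1,\dots,k\}$; $\log$ is the natural logarithm. -}

module Defs where

open import Data.Nat using (ℕ; zero; suc; _+_; _*_; _∸_; _≤ᵇ_; _≡ᵇ_; _⊔_)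
open import Data.Bool using (Bool; true; false; _∧_; if_then_else_)
open import Data.Fin using (Fin; toℕ)
open import Data.Vec using (Vec; []; _∷_)
open import Data.Maybe using (Maybe; just; nothing)
open import Data.List using (List; []; _∷_; map; concatMap; allFin; upTo; foldr)
open import Data.Bool.ListAction using (all; any)
open import Data.Nat.ListAction using (sum)

Word : ℕ → ℕ → Set
Word n k = Vec (Fin k) n

at : ∀ {n k} → Word n k → ℕ → Maybe (Fin k)
at []       _       = nothing
at (a ∷ w)  zero    = just a
at (a ∷ w)  (suc j) = at w j

eqᵇ : ∀ {k} → Maybe (Fin k) → Maybe (Fin k) → Bool
eqᵇ (just a) (just b) = toℕ a ≡ᵇ toℕ b
eqᵇ nothing  nothing  = true
eqᵇ _        _        = false

-- The factor w_i ... w_{i+rm-1} (0-based start i) is an r-power of length m: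
-- it fits in w, and w_j = w_{j+m} for all i ≤ j ≤ i+(r-1)m-1.
powerAtᵇ : ∀ {n k} → Word n k → (i r m : ℕ) → Bool
powerAtᵇ {n} w i r m =
  ((i + r * m) ≤ᵇ n) ∧ all (λ t → eqᵇ (at w (i + t)) (at w (i + t + m))) (upTo ((r ∸ 1) * m))

hasPowerᵇ : ∀ {n k} → Word n k → (r m : ℕ) → Bool
hasPowerᵇ {n} w r m = any (λ i → powerAtᵇ w i r m) (upTo (suc n))

-- Maximum power of length m in w: the largest r (searched over 0..n, which
-- contains every possible r when m ≥ 1) such that w contains an r-power of
-- length m; equals 0 if w contains no power of length m (i.e. when m > n).
maxPower : ∀ {n k} → Word n k → ℕ → ℕ
maxPower {n} w m = foldr _⊔_ 0 (map (λ r → if hasPowerᵇ w r m then r else 0) (upTo (suc n)))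

allWords : (n k : ℕ) → List (Word n k)
allWords zero    k = [] ∷ []
allWords (suc n) k = concatMap (λ a → map (a ∷_) (allWords n k)) (allFin k)

-- Σ_{w ∈ [k]^n} R(w); so E[R_{n,k,m}] = totalMaxPower n k m / k^n.
totalMaxPower : (n k m : ℕ) → ℕ
totalMaxPower n k m = sum (map (λ w → maxPower w m) (allWords n k))

{-# OPTIONS --safe #-}
module Submission where

-- Write B = k^m.  Since the set of r for which w contains an r-power of length m is
-- closed downwards, Σ_w R(w) ≤ Σ_{q<n} #{w : w contains a (q+1)-power}.  A fixed
-- (r+1)-power imposes r·m equalities w_t = w_{t+m}, each of which fixes one letter in
-- terms of later ones, so it occurs in at most k^n / B^r words; a union bound over the
-- n+1 starting positions gives #{w : w contains an (r+1)-power} ≤ (n+1) k^n / B^r.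
-- Taking r₀ with n+1 ≤ B^r₀ ≤ (n+1)B, the layers q < r₀ contribute at most r₀ k^n and
-- the others a geometric series of sum at most 2 k^n.  So Σ_w R(w) ≤ (r₀+2) k^n, and as
-- (n+1)B ≤ n B², exponentiating gives B^(Σ_w R(w)) ≤ (n B⁴)^(k^n), i.e. C = 3.

open import Defs
open import Data.Bool using (Bool; true; false; T; _∧_; if_then_else_)
open import Data.Bool.ListAction using (all; any; and)
open import Data.Bool.Properties using (T-∧; ∧-identityʳ; ∧-zeroʳ)
open import Data.Fin using (Fin; toℕ)
import Data.Fin as Fin
open import Data.Maybe using (Maybe; just; nothing)
open import Data.Vec using (_∷_)
open import Data.List using (List; []; _∷_; _++_; map; concatMap; allFin; upTo; length)
open import Data.List.Properties using (map-cong; map-∘; map-++; map-tabulate; length-tabulate; map-applyUpTo; map-upTo; length-upTo; foldr-preservesᵇ)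
open import Data.List.Membership.Propositional.Properties using (∈-upTo⁺; ∈-upTo⁻)
open import Data.List.Relation.Binary.Subset.Propositional using (_⊆_)
import Data.List.Relation.Unary.All.Properties as All
import Data.List.Relation.Unary.Any as Any
open import Data.List.Relation.Unary.Any.Properties using (any⁺; any⁻)
open import Data.Nat using (ℕ; zero; suc; _+_; _*_; _^_; _∸_; _≤_; _<_; _≥_; _≡ᵇ_; _≤ᵇ_; z≤n; s≤s; s≤s⁻¹; NonZero)
open import Data.Nat.ListAction using (sum)
open import Data.Nat.ListAction.Properties using (sum-++)
open import Data.Nat.Properties
open import Data.Nat.Tactic.RingSolver using (solve-∀)
open import Algebra.Properties.CommutativeSemigroup +-commutativeSemigroup using () renaming (interchange to +-interchange)
open import Algebra.Properties.CommutativeSemigroup *-commutativeSemigroup using (x∙yz≈y∙xz) renaming (interchange to *-interchange)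
open import Data.Product using (∃; _×_; _,_)
open import Function using (_∘_; id; const; Equivalence)
open import Relation.Binary.PropositionalEquality
open import Relation.Nullary using (yes; no)

open Equivalence using (to; from)

𝟙 : Bool → ℕ
𝟙 true  = 1
𝟙 false = 0

T⇒𝟙≡1 : ∀ {b} → T b → 𝟙 b ≡ 1
T⇒𝟙≡1 {true} _ = refl

count : {A : Set} → (A → Bool) → List A → ℕ
count p xs = sum (map (𝟙 ∘ p) xs)

𝟙-any≤count : {A : Set} (p : A → Bool) (xs : List A) → 𝟙 (any p xs) ≤ count p xs
𝟙-any≤count p []       = z≤n
𝟙-any≤count p (x ∷ xs) with p x
... | true  = s≤s z≤n
... | false = 𝟙-any≤count p xs

ifᵇ-≤ : ∀ b {r c} → (T b → r ≤ c) → (if b then r else 0) ≤ c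
ifᵇ-≤ true  r≤c = r≤c _
ifᵇ-≤ false _   = z≤n

module _ {A : Set} where

  sum-map-cong : ∀ {f g : A → ℕ} → (∀ x → f x ≡ g x) → ∀ xs → sum (map f xs) ≡ sum (map g xs)
  sum-map-cong f≗g = cong sum ∘ map-cong f≗g

  sum-map-mono : ∀ {f g : A → ℕ} → (∀ x → f x ≤ g x) → ∀ xs → sum (map f xs) ≤ sum (map g xs)
  sum-map-mono f≤g []       = z≤n
  sum-map-mono f≤g (x ∷ xs) = +-mono-≤ (f≤g x) (sum-map-mono f≤g xs)

  sum-map-const : ∀ c (xs : List A) → sum (map (const c) xs) ≡ length xs * c
  sum-map-const c []       = refl
  sum-map-const c (x ∷ xs) = cong (c +_) (sum-map-const c xs)

  sum-map-0 : ∀ (xs : List A) → sum (map (const 0) xs) ≡ 0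
  sum-map-0 xs = trans (sum-map-const 0 xs) (*-zeroʳ (length xs))

  sum-map-+ : ∀ (f g : A → ℕ) xs → sum (map (λ x → f x + g x) xs) ≡ sum (map f xs) + sum (map g xs)
  sum-map-+ f g []       = refl
  sum-map-+ f g (x ∷ xs) =
    trans (cong (f x + g x +_) (sum-map-+ f g xs)) (+-interchange (f x) (g x) _ _)

  sum-map-*ˡ : ∀ c (f : A → ℕ) xs → sum (map (λ x → c * f x) xs) ≡ c * sum (map f xs)
  sum-map-*ˡ c f []       = sym (*-zeroʳ c)
  sum-map-*ˡ c f (x ∷ xs) =
    trans (cong (c * f x +_) (sum-map-*ˡ c f xs)) (sym (*-distribˡ-+ c (f x) _))

  count≤length : ∀ (p : A → Bool) xs → count p xs ≤ length xs
  count≤length p []       = z≤n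
  count≤length p (x ∷ xs) with p x
  ... | true  = s≤s (count≤length p xs)
  ... | false = m≤n⇒m≤1+n (count≤length p xs)

  count-guard : ∀ b (p : A → Bool) xs {a c} →
                (T b → a * count p xs ≤ c) → a * count (λ x → b ∧ p x) xs ≤ c
  count-guard true  p xs h = h _
  count-guard false p xs {a} h = ≤-trans (≤-reflexive (trans (cong (a *_) (sum-map-0 xs)) (*-zeroʳ a))) z≤n

  module _ {B : Set} where

    sum-map-swap : ∀ (F : A → B → ℕ) xs ys →
                   sum (map (λ x → sum (map (F x) ys)) xs) ≡ sum (map (λ y → sum (map (λ x → F x y) xs)) ys)
    sum-map-swap F xs []       = sum-map-0 xs
    sum-map-swap F xs (y ∷ ys) =
      trans (sum-map-+ (λ x → F x y) (λ x → sum (map (F x) ys)) xs)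
            (cong (sum (map (λ x → F x y) xs) +_) (sum-map-swap F xs ys))

    sum-map-concatMap : ∀ (f : B → ℕ) (g : A → List B) xs →
                        sum (map f (concatMap g xs)) ≡ sum (map (λ x → sum (map f (g x))) xs)
    sum-map-concatMap f g []       = refl
    sum-map-concatMap f g (x ∷ xs) = begin
      sum (map f (g x ++ concatMap g xs))                ≡⟨ cong sum (map-++ f (g x) _) ⟩
      sum (map f (g x) ++ map f (concatMap g xs))        ≡⟨ sum-++ (map f (g x)) _ ⟩
      sum (map f (g x)) + sum (map f (concatMap g xs))   ≡⟨ cong (sum (map f (g x)) +_) (sum-map-concatMap f g xs) ⟩
      sum (map f (g x)) + sum (map (λ x → sum (map f (g x))) xs) ∎
      where open ≡-Reasoning

    count-any≤ : ∀ (p : A → B → Bool) xs ys →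
                 count (λ x → any (p x) ys) xs ≤ sum (map (λ y → count (λ x → p x y) xs) ys)
    count-any≤ p xs ys = ≤-trans (sum-map-mono (λ x → 𝟙-any≤count (p x) ys) xs)
                                 (≤-reflexive (sum-map-swap (λ x y → 𝟙 (p x y)) xs ys))

∑< : ℕ → (ℕ → ℕ) → ℕ
∑< zero    f = 0
∑< (suc N) f = ∑< N f + f N

syntax ∑< N (λ q → e) = ∑[ q < N ] e

sum-map-∑< : ∀ {A : Set} (F : A → ℕ → ℕ) xs N →
             sum (map (λ x → ∑< N (F x)) xs) ≡ ∑[ q < N ] sum (map (λ x → F x q) xs)
sum-map-∑< F xs zero    = sum-map-0 xs
sum-map-∑< F xs (suc N) =
  trans (sum-map-+ (λ x → ∑< N (F x)) (λ x → F x N) xs)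
        (cong (_+ sum (map (λ x → F x N) xs)) (sum-map-∑< F xs N))

∑<-+ : ∀ f a b → ∑< (a + b) f ≡ ∑< a f + ∑[ s < b ] f (a + s)
∑<-+ f a zero    = trans (cong (λ N → ∑< N f) (+-identityʳ a)) (sym (+-identityʳ _))
∑<-+ f a (suc b) = begin
  ∑< (a + suc b) f                                  ≡⟨ cong (λ N → ∑< N f) (+-suc a b) ⟩
  ∑< (a + b) f + f (a + b)                          ≡⟨ cong (_+ f (a + b)) (∑<-+ f a b) ⟩
  ∑< a f + ∑[ s < b ] f (a + s) + f (a + b)         ≡⟨ +-assoc (∑< a f) _ _ ⟩
  ∑< a f + (∑[ s < b ] f (a + s) + f (a + b))       ∎
  where open ≡-Reasoning

∑<-monoˡ : ∀ f {a b} → a ≤ b → ∑< a f ≤ ∑< b f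
∑<-monoˡ f {a} {b} a≤b = begin
  ∑< a f                                 ≤⟨ m≤m+n _ _ ⟩
  ∑< a f + ∑[ s < b ∸ a ] f (a + s)      ≡⟨ ∑<-+ f a (b ∸ a) ⟨
  ∑< (a + (b ∸ a)) f                     ≡⟨ cong (λ N → ∑< N f) (m+[n∸m]≡n a≤b) ⟩
  ∑< b f                                 ∎
  where open ≤-Reasoning

∑<-≤-* : ∀ {f c} N → (∀ q → f q ≤ c) → ∑< N f ≤ N * c
∑<-≤-* zero    f≤c = z≤n
∑<-≤-* {c = c} (suc N) f≤c = ≤-trans (+-mono-≤ (∑<-≤-* N f≤c) (f≤c N)) (≤-reflexive (+-comm (N * c) c))

≤-∑<-𝟙 : ∀ {p : ℕ → Bool} N → (∀ {q} → q < N → T (p q)) → N ≤ ∑[ q < N ] 𝟙 (p q)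
≤-∑<-𝟙 zero    _  = z≤n
≤-∑<-𝟙 {p} (suc N) pq = begin
  suc N                               ≡⟨ +-comm 1 N ⟩
  N + 1                               ≤⟨ +-mono-≤ (≤-∑<-𝟙 N (pq ∘ m<n⇒m<1+n)) (≤-reflexive (sym (T⇒𝟙≡1 (pq ≤-refl)))) ⟩
  ∑[ q < N ] 𝟙 (p q) + 𝟙 (p N)        ∎
  where open ≤-Reasoning

-- The invariant is  ∑< M y ≤ 2A − 2A / 2^M,  multiplied through by 2^M.
∑<-geometric : ∀ {y A} → (∀ s → 2 ^ s * y s ≤ A) → ∀ M → ∑< M y ≤ 2 * A
∑<-geometric {y} {A} 2ˢy≤A M =
  *-cancelˡ-≤ (2 ^ M) {{m^n≢0 2 M}} (≤-trans (m≤m+n _ (2 * A)) (invariant M))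
  where
    double-+ : ∀ x a → 2 * (x + a) + 2 * a ≡ 2 * (x + 2 * a)
    double-+ = solve-∀

    invariant : ∀ M → 2 ^ M * ∑< M y + 2 * A ≤ 2 ^ M * (2 * A)
    invariant zero    = ≤-reflexive (sym (*-identityˡ (2 * A)))
    invariant (suc M) = begin
      2 * 2 ^ M * (S + y M) + 2 * A            ≡⟨ cong (_+ 2 * A) (trans (*-assoc 2 (2 ^ M) _) (cong (2 *_) (*-distribˡ-+ (2 ^ M) S (y M)))) ⟩
      2 * (2 ^ M * S + 2 ^ M * y M) + 2 * A    ≤⟨ +-monoˡ-≤ (2 * A) (*-monoʳ-≤ 2 (+-monoʳ-≤ (2 ^ M * S) (2ˢy≤A M))) ⟩
      2 * (2 ^ M * S + A) + 2 * A              ≡⟨ double-+ (2 ^ M * S) A ⟩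
      2 * (2 ^ M * S + 2 * A)                  ≤⟨ *-monoʳ-≤ 2 (invariant M) ⟩
      2 * (2 ^ M * (2 * A))                    ≡⟨ *-assoc 2 (2 ^ M) (2 * A) ⟨
      2 * 2 ^ M * (2 * A)                      ∎
      where
        open ≤-Reasoning
        S = ∑< M y

sum-allWords-suc : ∀ n k (F : Word (suc n) k → ℕ) →
  sum (map F (allWords (suc n) k)) ≡ sum (map (λ a → sum (map (F ∘ (a ∷_)) (allWords n k))) (allFin k))
sum-allWords-suc n k F =
  trans (sum-map-concatMap F _ (allFin k)) (sum-map-cong (λ a → cong sum (sym (map-∘ (allWords n k)))) (allFin k))

sum-allFin-const : ∀ k c → sum (map (const c) (allFin k)) ≡ k * c
sum-allFin-const k c = trans (sum-map-const c (allFin k)) (cong (_* c) (length-tabulate {n = k} id))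

length-allWords : ∀ n k → length (allWords n k) ≡ k ^ n
length-allWords zero    k = refl
length-allWords (suc n) k = begin
  length (allWords (suc n) k)                                 ≡⟨ length≡sum-map-1 (allWords (suc n) k) ⟩
  sum (map (const 1) (allWords (suc n) k))                    ≡⟨ sum-allWords-suc n k (const 1) ⟩
  sum (map (λ _ → sum (map (const 1) (allWords n k))) (allFin k)) ≡⟨ sum-allFin-const k _ ⟩
  k * sum (map (const 1) (allWords n k))                      ≡⟨ cong (k *_) (length≡sum-map-1 (allWords n k)) ⟨
  k * length (allWords n k)                                   ≡⟨ cong (k *_) (length-allWords n k) ⟩
  k * k ^ n                                                   ∎
  where
    open ≡-Reasoning
    length≡sum-map-1 : ∀ {A : Set} (xs : List A) → length xs ≡ sum (map (const 1) xs)
    length≡sum-map-1 xs = sym (trans (sum-map-const 1 xs) (*-identityʳ (length xs)))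

count-allFin-suc : ∀ k (p : Fin (suc k) → Bool) → count p (allFin (suc k)) ≡ 𝟙 (p Fin.zero) + count (p ∘ Fin.suc) (allFin k)
count-allFin-suc k p =
  cong (λ xs → 𝟙 (p Fin.zero) + sum xs) (trans (map-tabulate Fin.suc (𝟙 ∘ p)) (sym (map-tabulate id (𝟙 ∘ p ∘ Fin.suc))))

count-toℕ≡ᵇ≤1 : ∀ k c → count (λ (a : Fin k) → toℕ a ≡ᵇ c) (allFin k) ≤ 1
count-toℕ≡ᵇ≤1 zero    c       = z≤n
count-toℕ≡ᵇ≤1 (suc k) zero    = ≤-reflexive (trans (count-allFin-suc k (λ a → toℕ a ≡ᵇ 0)) (cong suc (sum-map-0 (allFin k))))
count-toℕ≡ᵇ≤1 (suc k) (suc c) = ≤-trans (≤-reflexive (count-allFin-suc k (λ a → toℕ a ≡ᵇ suc c))) (count-toℕ≡ᵇ≤1 k c)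

count-eqᵇ-∧≤ : ∀ k (x : Maybe (Fin k)) b → count (λ (a : Fin k) → eqᵇ (just a) x ∧ b) (allFin k) ≤ 𝟙 b
count-eqᵇ-∧≤ k x        false =
  ≤-reflexive (trans (sum-map-cong (λ a → cong 𝟙 (∧-zeroʳ (eqᵇ (just a) x))) (allFin k)) (sum-map-0 (allFin k)))
count-eqᵇ-∧≤ k nothing  true  = ≤-trans (≤-reflexive (sum-map-0 (allFin k))) z≤n
count-eqᵇ-∧≤ k (just c) true  =
  ≤-trans (≤-reflexive (sum-map-cong (λ a → cong 𝟙 (∧-identityʳ _)) (allFin k))) (count-toℕ≡ᵇ≤1 k (toℕ c))

periodicᵇ : ∀ {n k} → Word n k → (m j L : ℕ) → Bool
periodicᵇ w m j L = all (λ t → eqᵇ (at w (j + t)) (at w (j + t + m))) (upTo L)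

all-upTo-suc : ∀ (p : ℕ → Bool) L → all p (upTo (suc L)) ≡ p 0 ∧ all (p ∘ suc) (upTo L)
all-upTo-suc p L = cong (λ bs → p 0 ∧ and bs) (trans (map-applyUpTo suc p L) (sym (map-upTo (p ∘ suc) L)))

-- Induct on the first letter: it is unconstrained when j > 0, and determined by the rest
-- of the word (it must equal w_m) when j = 0.
periodicᵇ-count : ∀ {k} m .{{_ : NonZero m}} n j L → j + L + m ≤ n →
                  k ^ L * count (λ (w : Word n k) → periodicᵇ w m j L) (allWords n k) ≤ k ^ n
periodicᵇ-count {k} m n j zero _ = begin
  1 * count _ (allWords n k)   ≡⟨ *-identityˡ _ ⟩
  count _ (allWords n k)       ≤⟨ count≤length _ (allWords n k) ⟩
  length (allWords n k)        ≡⟨ length-allWords n k ⟩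
  k ^ n                        ∎
  where open ≤-Reasoning
periodicᵇ-count m zero j (suc L) j+L+m≤0
  with () ← ≤-trans (≤-trans (m≤n+m (suc L) j) (m≤m+n (j + suc L) m)) j+L+m≤0
periodicᵇ-count {k} m (suc n) (suc j) L j+L+m≤n = begin
  k ^ L * count (λ w → periodicᵇ w m (suc j) L) (allWords (suc n) k)
    ≡⟨ cong (k ^ L *_) (trans (sum-allWords-suc n k _) (sum-allFin-const k X)) ⟩
  k ^ L * (k * X)
    ≡⟨ x∙yz≈y∙xz (k ^ L) k X ⟩
  k * (k ^ L * X)
    ≤⟨ *-monoʳ-≤ k (periodicᵇ-count m n j L (s≤s⁻¹ j+L+m≤n)) ⟩
  k * k ^ n ∎
  where
    open ≤-Reasoning
    X = count (λ w → periodicᵇ w m j L) (allWords n k)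
periodicᵇ-count zero {{()}} (suc n) zero (suc L) _
periodicᵇ-count {k} (suc m) (suc n) zero (suc L) L+m≤n = begin
  k ^ suc L * count (λ w → periodicᵇ w (suc m) 0 (suc L)) (allWords (suc n) k)
    ≡⟨ cong (k ^ suc L *_) (trans (sum-allWords-suc n k _) (sum-map-cong (λ a → sum-map-cong (λ w → cong 𝟙 (head a w)) (allWords n k)) (allFin k))) ⟩
  k ^ suc L * sum (map (λ a → count (λ w → eqᵇ (just a) (at w m) ∧ P w) (allWords n k)) (allFin k))
    ≡⟨ cong (k ^ suc L *_) (sum-map-swap (λ a w → 𝟙 (eqᵇ (just a) (at w m) ∧ P w)) (allFin k) (allWords n k)) ⟩
  k ^ suc L * sum (map (λ w → count (λ a → eqᵇ (just a) (at w m) ∧ P w) (allFin k)) (allWords n k))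
    ≤⟨ *-monoʳ-≤ (k ^ suc L) (sum-map-mono (λ w → count-eqᵇ-∧≤ k (at w m) (P w)) (allWords n k)) ⟩
  k ^ suc L * count P (allWords n k)
    ≡⟨ *-assoc k (k ^ L) _ ⟩
  k * (k ^ L * count P (allWords n k))
    ≤⟨ *-monoʳ-≤ k (periodicᵇ-count (suc m) n 0 L (s≤s⁻¹ L+m≤n)) ⟩
  k * k ^ n ∎
  where
    open ≤-Reasoning
    P : Word n k → Bool
    P w = periodicᵇ w (suc m) 0 L
    head : ∀ a w → periodicᵇ (a ∷ w) (suc m) 0 (suc L) ≡ eqᵇ (just a) (at w m) ∧ P w
    head a w = all-upTo-suc (λ t → eqᵇ (at (a ∷ w) t) (at (a ∷ w) (t + suc m))) L

powerAtᵇ-count : ∀ {k} m .{{_ : NonZero m}} n i r →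
                 k ^ (r * m) * count (λ (w : Word n k) → powerAtᵇ w i (suc r) m) (allWords n k) ≤ k ^ n
powerAtᵇ-count {k} m n i r =
  count-guard (i + suc r * m ≤ᵇ n) (λ w → periodicᵇ w m i (r * m)) (allWords n k) {a = k ^ (r * m)}
    (λ fits → periodicᵇ-count m n i (r * m) (≤-trans (≤-reflexive reassoc) (≤ᵇ⇒≤ _ n fits)))
  where
    reassoc : i + r * m + m ≡ i + suc r * m
    reassoc = trans (+-assoc i (r * m) m) (cong (i +_) (+-comm (r * m) m))

powerCount : (n k m r : ℕ) → ℕ
powerCount n k m r = count (λ w → hasPowerᵇ w r m) (allWords n k)

powerCount≤ : ∀ n k m r → powerCount n k m r ≤ k ^ n
powerCount≤ n k m r = ≤-trans (count≤length _ (allWords n k)) (≤-reflexive (length-allWords n k))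

powerCount-union : ∀ n k m .{{_ : NonZero m}} r → (k ^ m) ^ r * powerCount n k m (suc r) ≤ suc n * k ^ n
powerCount-union n k m r = begin
  (k ^ m) ^ r * powerCount n k m (suc r)
    ≡⟨ cong (_* powerCount n k m (suc r)) (trans (^-*-assoc k m r) (cong (k ^_) (*-comm m r))) ⟩
  k ^ (r * m) * count (λ w → any (λ i → powerAt w i) starts) (allWords n k)
    ≤⟨ *-monoʳ-≤ (k ^ (r * m)) (count-any≤ powerAt (allWords n k) starts) ⟩
  k ^ (r * m) * sum (map (λ i → count (λ w → powerAt w i) (allWords n k)) starts)
    ≡⟨ sum-map-*ˡ (k ^ (r * m)) _ starts ⟨
  sum (map (λ i → k ^ (r * m) * count (λ w → powerAt w i) (allWords n k)) starts)
    ≤⟨ sum-map-mono (λ i → powerAtᵇ-count m n i r) starts ⟩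
  sum (map (const (k ^ n)) starts)
    ≡⟨ trans (sum-map-const (k ^ n) starts) (cong (_* k ^ n) (length-upTo (suc n))) ⟩
  suc n * k ^ n ∎
  where
    open ≤-Reasoning
    starts = upTo (suc n)
    powerAt : Word n k → ℕ → Bool
    powerAt w i = powerAtᵇ w i (suc r) m

upTo-⊆ : ∀ {a b} → a ≤ b → upTo a ⊆ upTo b
upTo-⊆ a≤b i∈ = ∈-upTo⁺ (<-≤-trans (∈-upTo⁻ i∈) a≤b)

powerAtᵇ-anti : ∀ {n k} (w : Word n k) m {i r r′} → r′ ≤ r → T (powerAtᵇ w i r m) → T (powerAtᵇ w i r′ m)
powerAtᵇ-anti {n} w m {i} r′≤r power with to T-∧ power
... | fits , periodic =
  from T-∧ ( ≤⇒≤ᵇ (≤-trans (+-monoʳ-≤ i (*-monoˡ-≤ m r′≤r)) (≤ᵇ⇒≤ _ n fits))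
           , All.all-anti-mono _ (upTo-⊆ (*-monoˡ-≤ m (∸-monoˡ-≤ 1 r′≤r))) periodic )

hasPowerᵇ-anti : ∀ {n k} (w : Word n k) m {r r′} → r′ ≤ r → T (hasPowerᵇ w r m) → T (hasPowerᵇ w r′ m)
hasPowerᵇ-anti {n} w m r′≤r = any⁺ _ ∘ Any.map (powerAtᵇ-anti w m r′≤r) ∘ any⁻ _ (upTo (suc n))

maxPower≤∑ : ∀ {n k} (w : Word n k) m → maxPower w m ≤ ∑[ q < n ] 𝟙 (hasPowerᵇ w (suc q) m)
maxPower≤∑ {n} w m = foldr-preservesᵇ {P = _≤ ∑[ q < n ] 𝟙 (hasPowerᵇ w (suc q) m)} ⊔-lub z≤n (All.map⁺ (All.applyUpTo⁺₁ id (suc n) bound))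
  where
    bound : ∀ {r} → r < suc n → (if hasPowerᵇ w r m then r else 0) ≤ ∑[ q < n ] 𝟙 (hasPowerᵇ w (suc q) m)
    bound {zero}  _         = ifᵇ-≤ (hasPowerᵇ w 0 m) (λ _ → z≤n)
    bound {suc r} (s≤s r<n) = ifᵇ-≤ (hasPowerᵇ w (suc r) m) λ power →
      ≤-trans (≤-∑<-𝟙 (suc r) (λ q<r → hasPowerᵇ-anti w m q<r power)) (∑<-monoˡ _ r<n)

totalMaxPower≤∑powerCount : ∀ n k m → totalMaxPower n k m ≤ ∑[ q < n ] powerCount n k m (suc q)
totalMaxPower≤∑powerCount n k m =
  ≤-trans (sum-map-mono (λ w → maxPower≤∑ w m) (allWords n k))
          (≤-reflexive (sum-map-∑< (λ w q → 𝟙 (hasPowerᵇ w (suc q) m)) (allWords n k) n))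

∑<-≤-head-tail : ∀ {f K} r N → (∀ q → f q ≤ K) → (∀ s → 2 ^ s * f (r + s) ≤ K) → ∑< N f ≤ (r + 2) * K
∑<-≤-head-tail {f} {K} r N f≤K tail≤K = begin
  ∑< N f                          ≤⟨ ∑<-monoˡ f (m≤n+m N r) ⟩
  ∑< (r + N) f                    ≡⟨ ∑<-+ f r N ⟩
  ∑< r f + ∑[ s < N ] f (r + s)   ≤⟨ +-mono-≤ (∑<-≤-* r f≤K) (∑<-geometric tail≤K N) ⟩
  r * K + 2 * K                   ≡⟨ *-distribʳ-+ K r 2 ⟨
  (r + 2) * K                     ∎
  where open ≤-Reasoning

totalMaxPower≤ : ∀ n k m .{{_ : NonZero m}} r → 2 ≤ k ^ m → suc n ≤ (k ^ m) ^ r →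
                 totalMaxPower n k m ≤ (r + 2) * k ^ n
totalMaxPower≤ n k m r 2≤B n<Bʳ =
  ≤-trans (totalMaxPower≤∑powerCount n k m) (∑<-≤-head-tail r n (λ q → powerCount≤ n k m (suc q)) tail≤K)
  where
    B = k ^ m
    tail≤K : ∀ s → 2 ^ s * powerCount n k m (suc (r + s)) ≤ k ^ n
    tail≤K s = *-cancelˡ-≤ (suc n) (begin
      suc n * (2 ^ s * P)   ≤⟨ *-mono-≤ n<Bʳ (*-monoˡ-≤ P (^-monoˡ-≤ s 2≤B)) ⟩
      B ^ r * (B ^ s * P)   ≡⟨ *-assoc (B ^ r) (B ^ s) P ⟨
      B ^ r * B ^ s * P     ≡⟨ cong (_* P) (^-distribˡ-+-* B r s) ⟨
      B ^ (r + s) * P       ≤⟨ powerCount-union n k m (r + s) ⟩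
      suc n * k ^ n         ∎)
      where
        open ≤-Reasoning
        P = powerCount n k m (suc (r + s))

power-between : ∀ {B} → 2 ≤ B → ∀ x → ∃ λ r → suc x ≤ B ^ r × B ^ r ≤ suc x * B
power-between {B} 2≤B zero    = 0 , ≤-refl , ≤-trans (≤-trans (s≤s z≤n) 2≤B) (≤-reflexive (sym (*-identityˡ B)))
power-between {B} 2≤B (suc x) with power-between 2≤B x
... | r , x<Bʳ , Bʳ≤ with suc (suc x) ≤? B ^ r
...   | yes x+1<Bʳ = r , x+1<Bʳ , ≤-trans Bʳ≤ (*-monoˡ-≤ B (n≤1+n (suc x)))
...   | no  x+1≮Bʳ = suc r , lower , upper
  where
    Bʳ≡ : B ^ r ≡ suc x
    Bʳ≡ = ≤-antisym (s≤s⁻¹ (≰⇒> x+1≮Bʳ)) x<Bʳ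
    lower : suc (suc x) ≤ B * B ^ r
    lower = begin
      suc (suc x)   ≤⟨ s≤s (m≤n+m (suc x) x) ⟩
      suc x + suc x ≡⟨ cong (suc x +_) (+-identityʳ (suc x)) ⟨
      2 * suc x     ≤⟨ *-monoˡ-≤ (suc x) 2≤B ⟩
      B * suc x     ≡⟨ cong (B *_) Bʳ≡ ⟨
      B * B ^ r     ∎
      where open ≤-Reasoning
    upper : B * B ^ r ≤ suc (suc x) * B
    upper = begin
      B * B ^ r         ≡⟨ trans (cong (B *_) Bʳ≡) (*-comm B (suc x)) ⟩
      suc x * B         ≤⟨ *-monoˡ-≤ B (n≤1+n (suc x)) ⟩
      suc (suc x) * B   ∎
      where open ≤-Reasoning

^-distribʳ-* : ∀ a b c → (a * b) ^ c ≡ a ^ c * b ^ c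
^-distribʳ-* a b zero    = refl
^-distribʳ-* a b (suc c) = trans (cong (a * b *_) (^-distribʳ-* a b c)) (*-interchange a b (a ^ c) (b ^ c))

B^[r+2]≤n*B^4 : ∀ {B n} r → 1 ≤ n → 2 ≤ B → B ^ r ≤ suc n * B → B ^ (r + 2) ≤ n * B ^ 4
B^[r+2]≤n*B^4 {B} {n} r 1≤n 2≤B Bʳ≤ = begin
  B ^ (r + 2)         ≡⟨ ^-distribˡ-+-* B r 2 ⟩
  B ^ r * B ^ 2       ≤⟨ *-monoˡ-≤ (B ^ 2) (≤-trans Bʳ≤ (*-monoˡ-≤ B n+1≤Bn)) ⟩
  B * n * B * B ^ 2   ≡⟨ regroup B n ⟩
  n * B ^ 4           ∎
  where
    open ≤-Reasoning
    regroup : ∀ B n → B * n * B * (B * (B * 1)) ≡ n * (B * (B * (B * (B * 1))))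
    regroup = solve-∀
    n+1≤Bn : suc n ≤ B * n
    n+1≤Bn = begin
      suc n    ≤⟨ +-monoˡ-≤ n 1≤n ⟩
      n + n    ≡⟨ cong (n +_) (+-identityʳ n) ⟨
      2 * n    ≤⟨ *-monoˡ-≤ n 2≤B ⟩
      B * n    ∎

corollary4 : ∃ λ (C : ℕ) → ∀ (n k m : ℕ) → n ≥ 1 → k ≥ 2 → m ≥ 1 →
    k ^ (m * totalMaxPower n k m) ≤ n ^ (k ^ n) * k ^ (m * (1 + C) * k ^ n)
corollary4 = 3 , bound
  where
  bound : ∀ (n k m : ℕ) → n ≥ 1 → k ≥ 2 → m ≥ 1 → k ^ (m * totalMaxPower n k m) ≤ n ^ (k ^ n) * k ^ (m * 4 * k ^ n)
  bound n k@(suc _) m@(suc _) 1≤n 2≤k 1≤m = let (r , n<Bʳ , Bʳ≤) = power-between 2≤B n in begin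
    k ^ (m * S)              ≡⟨ ^-*-assoc k m S ⟨
    B ^ S                    ≤⟨ ^-monoʳ-≤ B {{m^n≢0 k m}} (totalMaxPower≤ n k m r 2≤B n<Bʳ) ⟩
    B ^ ((r + 2) * K)        ≡⟨ ^-*-assoc B (r + 2) K ⟨
    (B ^ (r + 2)) ^ K        ≤⟨ ^-monoˡ-≤ K (B^[r+2]≤n*B^4 r 1≤n 2≤B Bʳ≤) ⟩
    (n * B ^ 4) ^ K          ≡⟨ ^-distribʳ-* n (B ^ 4) K ⟩
    n ^ K * (B ^ 4) ^ K      ≡⟨ cong (n ^ K *_) (trans (^-*-assoc B 4 K) (trans (^-*-assoc k m (4 * K)) (cong (k ^_) (sym (*-assoc m 4 K))))) ⟩
    n ^ K * k ^ (m * 4 * K)  ∎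
    where
      open ≤-Reasoning
      B = k ^ m
      K = k ^ n
      S = totalMaxPower n k m
      2≤B : 2 ≤ B
      2≤B = ≤-trans 2≤k (≤-trans (≤-reflexive (sym (*-identityʳ k))) (^-monoʳ-≤ k 1≤m))
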